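{- Let $a\in\mathbb{N}$ with $a\geq 3$, and let $S(a)$ be the submonoid of $(\mathbb{N},+)$ generated by $\{f_a+f_n\mid n\in\mathbb{N}\}$. Then the minimal system of generators of $S(a)$ is $\{f_a+f_0, f_a+f_2, f_a+f_3,\ldots, f_a+f_{a-1}\}$.
   Context: $\{f_n\}$ is the Fibonacci sequence ($f_0=0$, $f_1=1$, $f_{n+2}=f_{n+1}+f_n$). A system of generators $X$ of a numerical semigroup $S$ is minimal if no proper subset of $X$ generates $S$; it exists and is unique. -}

module Defs where

open import Data.Nat using (ℕ; zero; suc; _+_; _≤_; _<_)
open import Data.Product using (Σ; ∃; _×_; _,_)
open import Relation.Binary.PropositionalEquality using (_≡_)
open import Relation.Nullary using (¬_)
open import Data.Empty using (⊥)
open import Data.Sum using (_⊎_)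

fib : ℕ → ℕ
fib zero = 0
fib (suc zero) = 1
fib (suc (suc n)) = fib (suc n) + fib n

Subset : Set₁
Subset = ℕ → Set

data Generated (G : Subset) : ℕ → Set where
  gen-zero : Generated G 0
  gen-add  : ∀ {g x} → G g → Generated G x → Generated G (g + x)

Generates : Subset → Subset → Set
Generates X S = ∀ x → (S x → Generated X x) × (Generated X x → S x)

IsMinimalSystemOfGenerators : Subset → Subset → Set₁
IsMinimalSystemOfGenerators X S =
  Generates X S ×
  ((Y : Subset) → (∀ x → Y x → X x) → (Σ ℕ λ x → X x × ¬ Y x) → ¬ Generates Y S)

SGens : ℕ → Subset
SGens a x = ∃ λ n → x ≡ fib a + fib n

S : ℕ → Subset
S a = Generated (SGens a)

MinGens : ℕ → Subset
MinGens a x = (x ≡ fib a + fib 0) ⊎ (∃ λ i → 2 ≤ i × i < a × x ≡ fib a + fib i)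

{-# OPTIONS --safe #-}
module Submission where

-- The proposed generators f_a + f_n (n = 0 or 2 ≤ n < a) all lie in [f_a, 2 f_a), so none
-- of them is a sum of two or more generators, which forces minimality. They generate S(a):
-- f_a + f_1 = f_a + f_2, and for n ≥ a, f_a + f_n = (f_a + f_0) + f_n where f_n lies in the
-- monoid generated by f_a = f_a + f_0 and f_(a+1) = f_a + f_(a-1) by the recurrence.

open import Defs
open import Data.Nat using (ℕ; zero; suc; _+_; _≤_; _<_; _≤′_; ≤′-refl; ≤′-step; z≤n; s≤s)
open import Data.Nat.Properties
open import Data.Product using (Σ; _×_; _,_; proj₁; proj₂)
open import Data.Sum using (_⊎_; inj₁; inj₂)
open import Relation.Nullary using (¬_; contradiction)
open import Relation.Binary.PropositionalEquality using (_≡_; refl; sym; subst)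

generated-singleton : ∀ {X : Subset} {g} → X g → Generated X g
generated-singleton {X} {g} Xg = subst (Generated X) (+-identityʳ g) (gen-add Xg gen-zero)

generated-+ : ∀ {X : Subset} {u v} → Generated X u → Generated X v → Generated X (u + v)
generated-+ gen-zero Gv = Gv
generated-+ {X} {v = v} (gen-add {g} {x} Xg Gx) Gv =
  subst (Generated X) (sym (+-assoc g x v)) (gen-add Xg (generated-+ Gx Gv))

generated-least : ∀ {X Y : Subset} → (∀ x → X x → Generated Y x) →
                  ∀ {u} → Generated X u → Generated Y u
generated-least X⊆⟨Y⟩ gen-zero = gen-zero
generated-least X⊆⟨Y⟩ (gen-add {g} Xg Gu) = generated-+ (X⊆⟨Y⟩ g Xg) (generated-least X⊆⟨Y⟩ Gu)

generates-generated : ∀ {X G : Subset} → (∀ x → X x → G x) → (∀ x → G x → Generated X x) →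
                      Generates X (Generated G)
generates-generated X⊆G G⊆⟨X⟩ x =
  generated-least G⊆⟨X⟩ , generated-least (λ y Xy → generated-singleton (X⊆G y Xy))

-- Any sum of two or more elements of Y is at least m + m.
generated-below-double : ∀ {Y : Subset} m → (∀ y → Y y → m ≤ y) →
                         ∀ {x} → Generated Y x → x < m + m → x ≡ 0 ⊎ Y x
generated-below-double m Y≥m gen-zero _ = inj₁ refl
generated-below-double {Y} m Y≥m (gen-add {g} Yg gen-zero) _ = inj₂ (subst Y (sym (+-identityʳ g)) Yg)
generated-below-double m Y≥m (gen-add {g} Yg (gen-add {g′} {r} Yg′ _)) x<2m =
  contradiction (+-mono-≤ (Y≥m g Yg) (≤-trans (Y≥m g′ Yg′) (m≤m+n g′ r))) (<⇒≱ x<2m)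

interval-generators-minimal : ∀ {X S : Subset} m → 1 ≤ m → (∀ x → X x → m ≤ x × x < m + m) →
                              Generates X S → IsMinimalSystemOfGenerators X S
interval-generators-minimal {X} {S} m m≥1 X-between X-gen = X-gen , minimal
  where
  minimal : (Y : Subset) → (∀ x → Y x → X x) → (Σ ℕ λ x → X x × ¬ Y x) → ¬ Generates Y S
  minimal Y Y⊆X (x , Xx , ¬Yx) Y-gen
    with generated-below-double m (λ y Yy → proj₁ (X-between y (Y⊆X y Yy)))
           (proj₁ (Y-gen x) (proj₂ (X-gen x) (generated-singleton Xx))) (proj₂ (X-between x Xx))
  ... | inj₁ refl = contradiction (proj₁ (X-between 0 Xx)) (<⇒≱ m≥1)
  ... | inj₂ Yx = ¬Yx Yx

fib-≤-fib-suc : ∀ n → fib n ≤ fib (suc n)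
fib-≤-fib-suc zero = z≤n
fib-≤-fib-suc (suc zero) = ≤-refl
fib-≤-fib-suc (suc (suc n)) = m≤m+n _ _

fib-mono : ∀ {i j} → i ≤ j → fib i ≤ fib j
fib-mono i≤j = go (≤⇒≤′ i≤j)
  where
  go : ∀ {i j} → i ≤′ j → fib i ≤ fib j
  go ≤′-refl = ≤-refl
  go {j = suc j} (≤′-step i≤′j) = ≤-trans (go i≤′j) (fib-≤-fib-suc j)

fib-suc-pos : ∀ n → 1 ≤ fib (suc n)
fib-suc-pos zero = ≤-refl
fib-suc-pos (suc n) = ≤-trans (fib-suc-pos n) (m≤m+n _ _)

fib-< : ∀ {i j} → 3 ≤ j → i < j → fib i < fib j
fib-< {j = suc (suc (suc k))} (s≤s (s≤s (s≤s _))) (s≤s i≤2+k) =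
  ≤-<-trans (fib-mono i≤2+k) (m<m+n (fib (suc (suc k))) (fib-suc-pos k))

generated-fib-from : ∀ {X : Subset} {k} → Generated X (fib k) → Generated X (fib (suc k)) →
                     ∀ {n} → k ≤ n → Generated X (fib n)
generated-fib-from {X} {k} Gfk Gfk+1 k≤n = proj₁ (go (≤⇒≤′ k≤n))
  where
  go : ∀ {n} → k ≤′ n → Generated X (fib n) × Generated X (fib (suc n))
  go ≤′-refl = Gfk , Gfk+1
  go (≤′-step k≤′n) with go k≤′n
  ... | Gfn , Gfn+1 = Gfn+1 , generated-+ Gfn+1 Gfn

MinGens-between : ∀ {a x} → 3 ≤ a → MinGens a x → fib a ≤ x × x < fib a + fib a
MinGens-between {a} a≥3 (inj₁ refl) =
  m≤m+n _ _ , +-monoʳ-< (fib a) (fib-< a≥3 (≤-trans (s≤s z≤n) a≥3))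
MinGens-between {a} a≥3 (inj₂ (i , _ , i<a , refl)) =
  m≤m+n _ _ , +-monoʳ-< (fib a) (fib-< a≥3 i<a)

fib+fib-∈-MinGens : ∀ {a n} → 3 ≤ a → n < a → MinGens a (fib a + fib n)
fib+fib-∈-MinGens {n = zero} _ _ = inj₁ refl
fib+fib-∈-MinGens {n = suc zero} a≥3 _ = inj₂ (2 , ≤-refl , a≥3 , refl)
fib+fib-∈-MinGens {n = suc (suc n)} _ n<a = inj₂ (suc (suc n) , s≤s (s≤s z≤n) , n<a , refl)

fib-suc-∈-MinGens : ∀ {a} → 3 ≤ a → MinGens a (fib (suc a))
fib-suc-∈-MinGens {suc (suc (suc k))} (s≤s (s≤s (s≤s _))) =
  inj₂ (suc (suc k) , s≤s (s≤s z≤n) , ≤-refl , refl)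

MinGens-generates : ∀ {a} → 3 ≤ a → ∀ x → SGens a x → Generated (MinGens a) x
MinGens-generates {a} a≥3 _ (n , refl) with <-≤-connex n a
... | inj₁ n<a = generated-singleton (fib+fib-∈-MinGens a≥3 n<a)
... | inj₂ a≤n = generated-+ ⟨fib-a⟩ (generated-fib-from ⟨fib-a⟩ ⟨fib-suc-a⟩ a≤n)
  where
  ⟨fib-a⟩ : Generated (MinGens a) (fib a)
  ⟨fib-a⟩ = subst (Generated (MinGens a)) (+-identityʳ (fib a)) (generated-singleton (inj₁ refl))
  ⟨fib-suc-a⟩ : Generated (MinGens a) (fib (suc a))
  ⟨fib-suc-a⟩ = generated-singleton (fib-suc-∈-MinGens a≥3)

MinGens⊆SGens : ∀ {a} x → MinGens a x → SGens a x
MinGens⊆SGens _ (inj₁ eq) = 0 , eq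
MinGens⊆SGens _ (inj₂ (i , _ , _ , eq)) = i , eq

proposition7 : (a : ℕ) → 3 ≤ a → IsMinimalSystemOfGenerators (MinGens a) (S a)
proposition7 a a≥3 =
  interval-generators-minimal (fib a) (fib-mono {1} (≤-trans (s≤s z≤n) a≥3))
    (λ x → MinGens-between a≥3) (generates-generated MinGens⊆SGens (MinGens-generates a≥3))
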